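{- Every maximal contraction graph has a vertex of degree one.
   Context: Let $G$ be a connected bipartite graph with bipartition $(A,B)$ and perfect matching $M=\{a_1b_1,\ldots,a_nb_n\}$ ($a_i\in A$, $b_i\in B$). A special subset is a set $\{a_{i_1},b_{i_1},\ldots,a_{i_k},b_{i_k}\}$ with distinct indices and $2\le k\le n$; it is a special elementary subset if the subgraph it induces is elementary, where a graph is elementary if it is connected and every edge lies in some perfect matching of it. $G$ is a maximal contraction graph if it has no special elementary subset (in particular a single edge is a maximal contraction graph). -}

module Defs where

open import Data.Nat using (ℕ; _≤_)
open import Data.Bool using (Bool; true; false)
open import Data.Fin using (Fin)
open import Data.Fin.Subset using (Subset; _∈_; ∣_∣)
open import Data.Sum using (_⊎_; inj₁; inj₂)
open import Data.Product using (Σ; ∃; ∃-syntax; _×_; _,_)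
open import Data.Empty using (⊥)
open import Relation.Binary.PropositionalEquality using (_≡_)
open import Relation.Binary.Construct.Closure.ReflexiveTransitive using (Star)

-- A bipartite graph with bipartition (A,B), |A| = |B| = n, and a fixed
-- perfect matching M = {a_i b_i}.  A = B = Fin n; vertex a_i is inj₁ i,
-- vertex b_i is inj₂ i.  The edges are given by E : Fin n → Fin n → Bool,
-- E i j ≡ true meaning a_i b_j is an edge.  The matching M requires E i i ≡ true.
Vertex : ℕ → Set
Vertex n = Fin n ⊎ Fin n

Adj : ∀ {n} → (Fin n → Fin n → Bool) → Vertex n → Vertex n → Set
Adj E (inj₁ i) (inj₂ j) = E i j ≡ true
Adj E (inj₂ j) (inj₁ i) = E i j ≡ true
Adj E (inj₁ _) (inj₁ _) = ⊥
Adj E (inj₂ _) (inj₂ _) = ⊥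

InducedConnected : ∀ {n} → (Fin n → Fin n → Bool) → (Vertex n → Set) → Set
InducedConnected {n} E P =
  (u v : Vertex n) → P u → P v → Star (λ x y → P x × P y × Adj E x y) u v

Connected : ∀ {n} → (Fin n → Fin n → Bool) → Set
Connected E = InducedConnected E (λ _ → Data.Unit.⊤)
  where import Data.Unit

SpecialVertices : ∀ {n} → Subset n → Vertex n → Set
SpecialVertices S (inj₁ i) = i ∈ S
SpecialVertices S (inj₂ i) = i ∈ S

IsPerfectMatchingOn : ∀ {n} → (Fin n → Fin n → Bool) → Subset n →
                      (Fin n → Fin n → Bool) → Set
IsPerfectMatchingOn {n} E S M =
  ((i j : Fin n) → M i j ≡ true → i ∈ S × j ∈ S × E i j ≡ true)
  × ((i : Fin n) → i ∈ S → ∃[ j ] (M i j ≡ true × ((j' : Fin n) → M i j' ≡ true → j' ≡ j)))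
  × ((j : Fin n) → j ∈ S → ∃[ i ] (M i j ≡ true × ((i' : Fin n) → M i' j ≡ true → i' ≡ i)))

Elementary : ∀ {n} → (Fin n → Fin n → Bool) → Subset n → Set
Elementary {n} E S =
  InducedConnected E (SpecialVertices S)
  × ((i j : Fin n) → i ∈ S → j ∈ S → E i j ≡ true →
       ∃[ M ] (IsPerfectMatchingOn E S M × M i j ≡ true))

-- special elementary subset: indices S with 2 ≤ |S| (|S| ≤ n automatic)
SpecialElementary : ∀ {n} → (Fin n → Fin n → Bool) → Subset n → Set
SpecialElementary E S = 2 ≤ ∣ S ∣ × Elementary E S

MaximalContraction : ∀ {n} → (Fin n → Fin n → Bool) → Set
MaximalContraction {n} E = (S : Subset n) → SpecialElementary E S → ⊥

DegreeOne : ∀ {n} → (Fin n → Fin n → Bool) → Vertex n → Set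
DegreeOne {n} E v = ∃[ w ] (Adj E v w × ((w' : Vertex n) → Adj E v w' → w' ≡ w))

{-# OPTIONS --safe #-}
-- Contracting every matching edge a_i b_i to a single vertex i turns G into the
-- digraph with an arc i → j for each non-matching edge a_i b_j.  If some i has no
-- out-arc, a_i has degree one.  Otherwise the digraph has a cycle; on a shortest
-- cycle C every vertex has exactly one out-neighbour and one in-neighbour in C,
-- since any other arc would close a shorter cycle.  So the edges induced on
-- {a_i, b_i : i ∈ C} are the edges a_i b_i and a_i b_{succ i}, forming two perfect
-- matchings, and the induced graph is connected along C: C is a special elementary
-- subset, contradicting maximality.
module Submission where

open import Defs
open import Data.Nat using (ℕ; zero; suc; _+_; _∸_; _≤_; _<_; z<s; s≤s; s≤s⁻¹)
open import Data.Nat.Properties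
  using (+-comm; +-suc; +-identityʳ; +-cancelˡ-≤; n≤0⇒n≡0; m<1+n⇒m<n∨m≡n; ≮⇒≥;
         m<n⇒0<n∸m; m+[n∸m]≡n; n<1+n; <⇒≤; ≤-trans)
open import Data.Nat.GeneralisedArithmetic using (iterate)
open import Data.Bool using (Bool; true)
import Data.Bool as Bool
open import Data.Fin as Fin using (Fin; toℕ; _≟_)
open import Data.Fin.Properties using (any?; all?; ¬∀⟶∃¬; pigeonhole)
open import Data.Fin.Subset using (Subset; _∈_; ∣_∣; ⁅_⁆; _∪_)
open import Data.Fin.Subset.Properties
  using (_∈?_; x∈⁅x⁆; x∈⁅y⁆⇒x≡y; x∈p∪q⁺; x∈p∪q⁻; ∣⁅x⁆∣≡1; p⊆q⇒∣p∣≤∣q∣;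
         x∈p∧x≢y⇒x∈p-y; x∈p⇒∣p-x∣<∣p∣)
open import Data.Product using (Σ; ∃; ∃₂; ∃-syntax; _×_; _,_; proj₁; proj₂)
open import Data.Sum using (_⊎_; inj₁; inj₂; [_,_])
import Data.Sum as Sum
open import Data.Empty using (⊥-elim)
open import Function.Bundles using (_⇔_; mk⇔; Equivalence)
open import Level using (_⊔_)
open import Relation.Binary.Core using (Rel)
open import Relation.Binary.Definitions using (Decidable)
open import Relation.Binary.PropositionalEquality using (_≡_; _≢_; refl; sym; trans; cong; subst)
open import Relation.Binary.Construct.Closure.ReflexiveTransitive using (Star; ε; _◅_; _◅◅_; reverse)
open import Relation.Nullary using (¬_; Dec; yes; no; does; ¬?)
open import Relation.Nullary.Decidable using (map′; dec-true; _×-dec_)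

open Equivalence using (to; from)

m+n≤m⇒n≡0 : ∀ m {n} → m + n ≤ m → n ≡ 0
m+n≤m⇒n≡0 m {n} le = n≤0⇒n≡0 (+-cancelˡ-≤ m n 0 (subst (m + n ≤_) (sym (+-identityʳ m)) le))

∃-least : ∀ {p} {P : ℕ → Set p} → (∀ k → Dec (P k)) → ∀ {k} → P k →
          ∃ λ m → P m × (∀ {j} → j < m → ¬ P j)
∃-least {P = P} P? {k} Pk = search k 0 (λ ()) (subst P (sym (+-identityʳ k)) Pk)
  where
  search : ∀ d i → (∀ {j} → j < i → ¬ P j) → P (d + i) → ∃ λ m → P m × (∀ {j} → j < m → ¬ P j)
  search zero i below Pi = i , Pi , below
  search (suc d) i below P[1+d+i] with P? i
  ... | yes Pi = i , Pi , below
  ... | no ¬Pi = search d (suc i) below′ (subst P (sym (+-suc d i)) P[1+d+i])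
    where
    below′ : ∀ {j} → j < suc i → ¬ P j
    below′ j<1+i = [ below , (λ { refl → ¬Pi }) ] (m<1+n⇒m<n∨m≡n j<1+i)

module _ {a ℓ} {A : Set a} {R : Rel A ℓ} where

  private variable
    x y z s u v : A

  length : Star R x y → ℕ
  length ε       = 0
  length (_ ◅ w) = suc (length w)

  length-◅◅ : (p : Star R x y) (q : Star R y z) → length (p ◅◅ q) ≡ length p + length q
  length-◅◅ ε       q = refl
  length-◅◅ (_ ◅ p) q = cong suc (length-◅◅ p q)

  length-◅◅-comm : (p : Star R x y) (q : Star R y x) → length (q ◅◅ p) ≡ length (p ◅◅ q)
  length-◅◅-comm p q = trans (length-◅◅ q p) (trans (+-comm (length q) (length p)) (sym (length-◅◅ p q)))

  length≡0⇒≡ : (w : Star R x y) → length w ≡ 0 → x ≡ y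
  length≡0⇒≡ ε _ = refl

  infix 4 _∈ᵛ_

  _∈ᵛ_ : A → Star R x y → Set a
  _∈ᵛ_ {x = x} u ε       = u ≡ x
  _∈ᵛ_ {x = x} u (_ ◅ w) = u ≡ x ⊎ u ∈ᵛ w

  ∈ᵛ-start : (w : Star R x y) → x ∈ᵛ w
  ∈ᵛ-start ε       = refl
  ∈ᵛ-start (_ ◅ _) = inj₁ refl

  ∈ᵛ-end : (w : Star R x y) → y ∈ᵛ w
  ∈ᵛ-end ε       = refl
  ∈ᵛ-end (_ ◅ w) = inj₂ (∈ᵛ-end w)

  ∈ᵛ-◅◅⁺ˡ : (p : Star R x y) (q : Star R y z) → u ∈ᵛ p → u ∈ᵛ p ◅◅ q
  ∈ᵛ-◅◅⁺ˡ ε       q refl       = ∈ᵛ-start q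
  ∈ᵛ-◅◅⁺ˡ (_ ◅ p) q (inj₁ u≡x) = inj₁ u≡x
  ∈ᵛ-◅◅⁺ˡ (_ ◅ p) q (inj₂ u∈p) = inj₂ (∈ᵛ-◅◅⁺ˡ p q u∈p)

  ∈ᵛ-◅◅⁺ʳ : (p : Star R x y) (q : Star R y z) → u ∈ᵛ q → u ∈ᵛ p ◅◅ q
  ∈ᵛ-◅◅⁺ʳ ε       q u∈q = u∈q
  ∈ᵛ-◅◅⁺ʳ (_ ◅ p) q u∈q = inj₂ (∈ᵛ-◅◅⁺ʳ p q u∈q)

  ∈ᵛ-◅◅⁻ : (p : Star R x y) (q : Star R y z) → u ∈ᵛ p ◅◅ q → u ∈ᵛ p ⊎ u ∈ᵛ q
  ∈ᵛ-◅◅⁻ ε       q u∈q          = inj₂ u∈q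
  ∈ᵛ-◅◅⁻ (_ ◅ p) q (inj₁ u≡x)   = inj₁ (inj₁ u≡x)
  ∈ᵛ-◅◅⁻ (_ ◅ p) q (inj₂ u∈pq) = Sum.map₁ inj₂ (∈ᵛ-◅◅⁻ p q u∈pq)

  ∈ᵛ-◅◅-comm : (p : Star R x y) (q : Star R y x) → u ∈ᵛ p ◅◅ q → u ∈ᵛ q ◅◅ p
  ∈ᵛ-◅◅-comm p q u∈pq = [ ∈ᵛ-◅◅⁺ʳ q p , ∈ᵛ-◅◅⁺ˡ q p ] (∈ᵛ-◅◅⁻ p q u∈pq)

  ∈ᵛ-cycle-tail : (r : R x y) (w : Star R y x) → u ∈ᵛ r ◅ w → u ∈ᵛ w
  ∈ᵛ-cycle-tail _ w (inj₁ refl) = ∈ᵛ-end w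
  ∈ᵛ-cycle-tail _ w (inj₂ u∈w)  = u∈w

  ∈ᵛ⇒◅◅ : (w : Star R x y) → u ∈ᵛ w → ∃₂ λ (p : Star R x u) (q : Star R u y) → w ≡ p ◅◅ q
  ∈ᵛ⇒◅◅ ε       refl        = ε , ε , refl
  ∈ᵛ⇒◅◅ (r ◅ w) (inj₁ refl) = ε , r ◅ w , refl
  ∈ᵛ⇒◅◅ (r ◅ w) (inj₂ u∈w) with p , q , refl ← ∈ᵛ⇒◅◅ w u∈w = r ◅ p , q , refl

  ∈ᵛ⇒prefix : (w : Star R x y) → u ∈ᵛ w → Σ (Star R x u) λ p → ∀ {v} → v ∈ᵛ p → v ∈ᵛ w
  ∈ᵛ⇒prefix w u∈w with p , q , refl ← ∈ᵛ⇒◅◅ w u∈w = p , ∈ᵛ-◅◅⁺ˡ p q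

  last-step : (w : Star R x y) → 0 < length w → ∃ λ z → z ∈ᵛ w × R z y
  last-step (r ◅ ε)           _ = _ , inj₁ refl , r
  last-step (_ ◅ w@(_ ◅ _)) _ with z , z∈w , r ← last-step w z<s = z , inj₂ z∈w , r

  IsShortestCycle : Star R x x → Set (a ⊔ ℓ)
  IsShortestCycle c = 0 < length c × (∀ {y} (c′ : Star R y y) → 0 < length c′ → length c ≤ length c′)

  shortest-rotate : {c : Star R x x} → IsShortestCycle c → u ∈ᵛ c →
                    Σ (Star R u u) λ c′ → IsShortestCycle c′ × (∀ {v} → v ∈ᵛ c′ ⇔ v ∈ᵛ c)
  shortest-rotate {c = c} (pos , min) u∈c with p , q , refl ← ∈ᵛ⇒◅◅ c u∈c =
    q ◅◅ p ,
    (subst (0 <_) (sym |qp|≡|pq|) pos , λ c′ pos′ → subst (_≤ length c′) (sym |qp|≡|pq|) (min c′ pos′)) ,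
    mk⇔ (∈ᵛ-◅◅-comm q p) (∈ᵛ-◅◅-comm p q)
    where
    |qp|≡|pq| = length-◅◅-comm p q

  -- A chord x → y or y → s of the cycle x → s ⋯ y ⋯ x would close a shorter cycle.
  shortest-out : (r : R x s) (w : Star R s x) → IsShortestCycle (r ◅ w) → y ∈ᵛ w → R x y → y ≡ s
  shortest-out r w (_ , min) y∈w x→y with p , q , refl ← ∈ᵛ⇒◅◅ w y∈w =
    sym (length≡0⇒≡ p (m+n≤m⇒n≡0 (length q)
      (subst (_≤ length q) |pq|≡|q|+|p| (s≤s⁻¹ (min (x→y ◅ q) z<s)))))
    where
    |pq|≡|q|+|p| = trans (length-◅◅ p q) (+-comm (length p) (length q))

  shortest-in : (r : R x s) (w : Star R s x) → IsShortestCycle (r ◅ w) → y ∈ᵛ w → R y s → y ≡ x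
  shortest-in r w (_ , min) y∈w y→s with p , q , refl ← ∈ᵛ⇒◅◅ w y∈w =
    length≡0⇒≡ q (m+n≤m⇒n≡0 (length p)
      (subst (_≤ length p) (length-◅◅ p q) (s≤s⁻¹ (min (y→s ◅ p) z<s))))

  shortest⇒successor : {c : Star R x x} → IsShortestCycle c → u ∈ᵛ c →
                       ∃ λ s → (s ∈ᵛ c × R u s) × (∀ {y} → y ∈ᵛ c → R u y → y ≡ s)
  shortest⇒successor sh u∈c with shortest-rotate sh u∈c
  ... | ε     , (() , _) , _
  ... | r ◅ w , sh′      , c′⇔c =
    _ , (to c′⇔c (inj₂ (∈ᵛ-start w)) , r) ,
    λ y∈c u→y → shortest-out r w sh′ (∈ᵛ-cycle-tail r w (from c′⇔c y∈c)) u→y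

  shortest⇒predecessor : {c : Star R x x} → IsShortestCycle c → y ∈ᵛ c →
                         ∃ λ b → (b ∈ᵛ c × R b y) × (∀ {b′} → b′ ∈ᵛ c → R b′ y → b′ ≡ b)
  shortest⇒predecessor {y = y} {c = c} sh y∈c
    with c′ , (pos , _) , c′⇔c ← shortest-rotate sh y∈c
    with b , b∈c′ , b→y ← last-step c′ pos
    = b , (to c′⇔c b∈c′ , b→y) , unique (shortest-rotate sh (to c′⇔c b∈c′)) b→y
    where
    unique : (Σ (Star R b b) λ c″ → IsShortestCycle c″ × (∀ {v} → v ∈ᵛ c″ ⇔ v ∈ᵛ c)) →
             R b y → ∀ {b′} → b′ ∈ᵛ c → R b′ y → b′ ≡ b
    unique (ε     , (() , _) , _)
    unique (r ◅ w , sh′ , c″⇔c) b→y b′∈c b′→y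
      with refl ← shortest-out r w sh′ (∈ᵛ-cycle-tail r w (from c″⇔c y∈c)) b→y
      = shortest-in r w sh′ (∈ᵛ-cycle-tail r w (from c″⇔c b′∈c)) b′→y

module _ {n ℓ} {R : Rel (Fin n) ℓ} where

  module _ (R? : Decidable R) where

    walk? : ∀ k x y → Dec (∃ λ (w : Star R x y) → length w ≡ k)
    walk? zero    x y = map′ (λ { refl → ε , refl }) (λ { (ε , _) → refl ; (_ ◅ _ , ()) }) (x ≟ y)
    walk? (suc k) x y = map′ (λ { (z , r , w , refl) → r ◅ w , refl })
                             (λ { (ε , ()) ; (r ◅ w , refl) → _ , r , w , refl })
                             (any? λ z → R? x z ×-dec walk? k z y)

    shortestCycle : ∀ {x} (c : Star R x x) → 0 < length c → ∃ λ y → Σ (Star R y y) IsShortestCycle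
    shortestCycle (r ◅ c) _
      with m , (y , w , |w|≡1+m) , shorter ← ∃-least (λ k → any? λ y → walk? (suc k) y y) (_ , r ◅ c , refl)
      = y , w , subst (0 <_) (sym |w|≡1+m) z<s ,
        λ c′ pos → subst (_≤ length c′) (sym |w|≡1+m) (minimal c′ pos)
      where
      minimal : ∀ {z} (c′ : Star R z z) → 0 < length c′ → suc m ≤ length c′
      minimal (r′ ◅ c′) _ = s≤s (≮⇒≥ λ |c′|<m → shorter |c′|<m (_ , r′ ◅ c′ , refl))

  module _ (out : ∀ x → ∃ (R x)) where

    private
      next : Fin n → Fin n
      next x = proj₁ (out x)

    follow : ∀ x k → Star R x (iterate next x k)
    follow x zero    = ε
    follow x (suc k) = proj₂ (out x) ◅ follow (next x) k

    length-follow : ∀ x k → length (follow x k) ≡ k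
    length-follow x zero    = refl
    length-follow x (suc k) = cong suc (length-follow (next x) k)

    iterate-+ : ∀ x i k → iterate next x (i + k) ≡ iterate next (iterate next x i) k
    iterate-+ x zero    k = refl
    iterate-+ x (suc i) k = iterate-+ (next x) i k

    cycle : Fin n → ∃ λ y → Σ (Star R y y) λ c → 0 < length c
    cycle x with i , j , i<j , xᵢ≡xⱼ ← pigeonhole (n<1+n n) (λ i → iterate next x (toℕ i)) =
      xᵢ , subst (λ z → Σ (Star R xᵢ z) λ c → 0 < length c) returns
                 (follow xᵢ d , subst (0 <_) (sym (length-follow xᵢ d)) (m<n⇒0<n∸m i<j))
      where
      xᵢ = iterate next x (toℕ i)
      d = toℕ j ∸ toℕ i
      returns : iterate next xᵢ d ≡ xᵢ
      returns = trans (sym (iterate-+ x (toℕ i) d))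
                      (trans (cong (iterate next x) (m+[n∸m]≡n (<⇒≤ i<j))) (sym xᵢ≡xⱼ))

dec-true⁻¹ : ∀ {p} {P : Set p} (P? : Dec P) → does P? ≡ true → P
dec-true⁻¹ (yes p) _ = p

x∈p⇒1≤∣p∣ : ∀ {n} {x : Fin n} {p : Subset n} → x ∈ p → 1 ≤ ∣ p ∣
x∈p⇒1≤∣p∣ {x = x} {p} x∈p =
  subst (_≤ ∣ p ∣) (∣⁅x⁆∣≡1 x) (p⊆q⇒∣p∣≤∣q∣ λ y∈⁅x⁆ → subst (_∈ p) (sym (x∈⁅y⁆⇒x≡y x y∈⁅x⁆)) x∈p)

x≢y⇒2≤∣p∣ : ∀ {n} {x y : Fin n} {p : Subset n} → x ≢ y → x ∈ p → y ∈ p → 2 ≤ ∣ p ∣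
x≢y⇒2≤∣p∣ x≢y x∈p y∈p = ≤-trans (s≤s (x∈p⇒1≤∣p∣ (x∈p∧x≢y⇒x∈p-y x∈p x≢y))) (x∈p⇒∣p-x∣<∣p∣ y∈p)

module _ {n ℓ} {R : Fin n → Fin n → Set ℓ} where

  vertices : ∀ {x y} → Star R x y → Subset n
  vertices {x = x} ε       = ⁅ x ⁆
  vertices {x = x} (_ ◅ w) = ⁅ x ⁆ ∪ vertices w

  ∈-vertices⁺ : ∀ {x y u} (w : Star R x y) → u ∈ᵛ w → u ∈ vertices w
  ∈-vertices⁺ ε       refl        = x∈⁅x⁆ _
  ∈-vertices⁺ (_ ◅ w) (inj₁ refl) = x∈p∪q⁺ (inj₁ (x∈⁅x⁆ _))
  ∈-vertices⁺ (_ ◅ w) (inj₂ u∈w)  = x∈p∪q⁺ (inj₂ (∈-vertices⁺ w u∈w))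

  ∈-vertices⁻ : ∀ {x y u} (w : Star R x y) → u ∈ vertices w → u ∈ᵛ w
  ∈-vertices⁻ ε       u∈w = x∈⁅y⁆⇒x≡y _ u∈w
  ∈-vertices⁻ (_ ◅ w) u∈w = Sum.map (x∈⁅y⁆⇒x≡y _) (∈-vertices⁻ w) (x∈p∪q⁻ _ _ u∈w)

module _ {n} (E : Fin n → Fin n → Bool) where

  Arc : Fin n → Fin n → Set
  Arc i j = E i j ≡ true × i ≢ j

  Arc? : ∀ i j → Dec (Arc i j)
  Arc? i j = (E i j Bool.≟ true) ×-dec ¬? (i ≟ j)

  perfectMatching : ∀ {S} (Q : Fin n → Fin n → Set) (Q? : ∀ i j → Dec (Q i j)) →
    (∀ {i j} → Q i j → i ∈ S × j ∈ S × E i j ≡ true) →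
    (∀ {i} → i ∈ S → ∃[ j ] (Q i j × ∀ {j′} → Q i j′ → j′ ≡ j)) →
    (∀ {j} → j ∈ S → ∃[ i ] (Q i j × ∀ {i′} → Q i′ j → i′ ≡ i)) →
    IsPerfectMatchingOn E S (λ i j → does (Q? i j))
  perfectMatching Q Q? Q⊆E rowUnique columnUnique =
    (λ i j Qij → Q⊆E (dec-true⁻¹ (Q? i j) Qij)) ,
    (λ i i∈S → let j , Qij , unique = rowUnique i∈S in
      j , dec-true (Q? i j) Qij , λ j′ Qij′ → unique (dec-true⁻¹ (Q? i j′) Qij′)) ,
    (λ j j∈S → let i , Qij , unique = columnUnique j∈S in
      i , dec-true (Q? i j) Qij , λ i′ Qi′j → unique (dec-true⁻¹ (Q? i′ j) Qi′j))

  module _ (diag : ∀ i → E i i ≡ true) where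

    identityMatching : ∀ S → IsPerfectMatchingOn E S (λ i j → does (i ∈? S ×-dec i ≟ j))
    identityMatching S = perfectMatching _ (λ i j → i ∈? S ×-dec i ≟ j)
      (λ { (i∈S , refl) → i∈S , i∈S , diag _ })
      (λ i∈S → _ , (i∈S , refl) , λ { (_ , refl) → refl })
      (λ j∈S → _ , (j∈S , refl) , λ { (_ , refl) → refl })

    successorMatching : ∀ {x} {c : Star Arc x x} → IsShortestCycle c →
      IsPerfectMatchingOn E (vertices c) (λ i j → does (i ∈? vertices c ×-dec j ∈? vertices c ×-dec Arc? i j))
    successorMatching {c = c} sh = perfectMatching _ (λ i j → i ∈? S ×-dec j ∈? S ×-dec Arc? i j)
      (λ { (i∈S , j∈S , Eij , _) → i∈S , j∈S , Eij })
      (λ i∈S → let j , (j∈c , i→j) , unique = shortest⇒successor sh (∈-vertices⁻ c i∈S) in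
        j , (i∈S , ∈-vertices⁺ c j∈c , i→j) , λ (_ , j′∈S , i→j′) → unique (∈-vertices⁻ c j′∈S) i→j′)
      (λ j∈S → let i , (i∈c , i→j) , unique = shortest⇒predecessor sh (∈-vertices⁻ c j∈S) in
        i , (∈-vertices⁺ c i∈c , j∈S , i→j) , λ (i′∈S , _ , i′→j) → unique (∈-vertices⁻ c i′∈S) i′→j)
      where
      S = vertices c

    InducedAdj : Subset n → Vertex n → Vertex n → Set
    InducedAdj S u v = SpecialVertices S u × SpecialVertices S v × Adj E u v

    module _ {S : Subset n} where

      lift : ∀ {x y} (w : Star Arc x y) → (∀ {u} → u ∈ᵛ w → u ∈ S) → Star (InducedAdj S) (inj₁ x) (inj₁ y)
      lift ε         _   = ε
      lift (_◅_ {j = y} x→y w) w⊆S =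
        _◅_ {j = inj₂ y} (w⊆S (inj₁ refl) , y∈S , proj₁ x→y)
                         ((y∈S , y∈S , diag y) ◅ lift w (λ u∈w → w⊆S (inj₂ u∈w)))
        where
        y∈S = w⊆S (inj₂ (∈ᵛ-start w))

      connected : ∀ {root} → (∀ {i} → i ∈ S → Star (InducedAdj S) root (inj₁ i)) →
                  InducedConnected E (SpecialVertices S)
      connected {root} reach u v u∈S v∈S = reverse flip (reach′ u u∈S) ◅◅ reach′ v v∈S
        where
        reach′ : ∀ u → SpecialVertices S u → Star (InducedAdj S) root u
        reach′ (inj₁ i) i∈S = reach i∈S
        reach′ (inj₂ i) i∈S = reach i∈S ◅◅ (i∈S , i∈S , diag i) ◅ ε
        flip : ∀ {u v} → InducedAdj S u v → InducedAdj S v u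
        flip {inj₁ _} {inj₂ _} (u∈S , v∈S , uv) = v∈S , u∈S , uv
        flip {inj₂ _} {inj₁ _} (u∈S , v∈S , uv) = v∈S , u∈S , uv

    shortestCycle⇒specialElementary : ∀ {x} {c : Star Arc x x} → IsShortestCycle c →
                                      SpecialElementary E (vertices c)
    shortestCycle⇒specialElementary {x} {c} sh = atLeastTwo , connected reach , matchable
      where
      atLeastTwo : 2 ≤ ∣ vertices c ∣
      atLeastTwo with s , (s∈c , _ , x≢s) , _ ← shortest⇒successor sh (∈ᵛ-start c) =
        x≢y⇒2≤∣p∣ x≢s (∈-vertices⁺ c (∈ᵛ-start c)) (∈-vertices⁺ c s∈c)
      reach : ∀ {i} → i ∈ vertices c → Star (InducedAdj (vertices c)) (inj₁ x) (inj₁ i)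
      reach i∈S = let p , p⊆c = ∈ᵛ⇒prefix c (∈-vertices⁻ c i∈S) in
                  lift p (λ u∈p → ∈-vertices⁺ c (p⊆c u∈p))
      matchable : ∀ i j → i ∈ vertices c → j ∈ vertices c → E i j ≡ true →
                  ∃[ M ] (IsPerfectMatchingOn E (vertices c) M × M i j ≡ true)
      matchable i j i∈S j∈S Eij with i ≟ j
      ... | yes refl = _ , identityMatching (vertices c) ,
                       dec-true (i ∈? vertices c ×-dec i ≟ i) (i∈S , refl)
      ... | no  i≢j  = _ , successorMatching sh ,
                       dec-true (i ∈? vertices c ×-dec j ∈? vertices c ×-dec Arc? i j) (i∈S , j∈S , Eij , i≢j)

    sink⇒degreeOne : ∀ {i} → (∀ j → ¬ Arc i j) → DegreeOne E (inj₁ i)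
    sink⇒degreeOne {i} sink = inj₂ i , diag i , only
      where
      only : ∀ w → Adj E (inj₁ i) w → w ≡ inj₂ i
      only (inj₂ j) Eij with j ≟ i
      ... | yes refl = refl
      ... | no  j≢i  = ⊥-elim (sink j (Eij , λ i≡j → j≢i (sym i≡j)))

proposition18 : (n : ℕ) → 1 ≤ n → (E : Fin n → Fin n → Bool) →
    ((i : Fin n) → E i i ≡ true) →
    Connected E →
    MaximalContraction E →
    ∃[ v ] DegreeOne E v
proposition18 zero    ()
proposition18 (suc n) _ E diag _ maxContraction with all? (λ i → any? (Arc? E i))
... | no ¬out with i , sink ← ¬∀⟶∃¬ _ _ (λ i → any? (Arc? E i)) ¬out =
  inj₁ i , sink⇒degreeOne E diag λ j i→j → sink (j , i→j)
... | yes out with _ , c₀ , c₀-nonempty ← cycle out Fin.zero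
              with _ , c , shortest ← shortestCycle (Arc? E) c₀ c₀-nonempty =
  ⊥-elim (maxContraction (vertices c) (shortestCycle⇒specialElementary E diag shortest))
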